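{- Let $\Pi$ be a ground program with atom set $\mathcal{A}$ and $A\subseteq\mathcal{A}$. If $\mathit{omit}(\Pi,A)$ is unsatisfiable, then $\mathit{omit}(\Pi,A)$ is a refinement-safe faithful abstraction.
   Context: Ground programs consist of rules $\alpha_0 \leftarrow \alpha_1,\dots,\alpha_m,\mathit{not}\ \alpha_{m+1},\dots,\mathit{not}\ \alpha_n$ with $\alpha_0$ an atom or $\bot$ (constraint), possibly with choice rules $\{\alpha\}\leftarrow B$ (abbreviating $\alpha\leftarrow B,\mathit{not}\ \bar\alpha$ and $\bar\alpha\leftarrow B,\mathit{not}\ \alpha$ with fresh $\bar\alpha$, projected away from answer sets). $H(r)$, $B^+(r)$, $B^-(r)$, $B^\pm(r)=B^+(r)\cup B^-(r)$, $B(r)$ denote head, positive body, negative body, all body atoms, and body. $I$ is an answer set of $\Pi$ iff $I$ is a $\subseteq$-minimal model of $\{r\in\Pi\mid I\models B(r)\}$; $AS(\Pi)$ is the set of answer sets; a program is unsatisfiable if it has no answer set. For $A\subseteq\mathcal{A}$, $\mathit{omit}(r,A)$ is $r$ if $A\cap B^\pm(r)=\emptyset$ and $H(r)\notin A$; is $\{H(r)\}\leftarrow B^+(r)\setminus A,\mathit{not}\ (B^-(r)\setminus A)$ if $A\cap B^\pm(r)\neq\emptyset$ and $H(r)\notin A\cup\{\bot\}$; and is no rule otherwise (choice rules treated analogously). $\mathit{omit}(\Pi,A)=\bigcup_{r\in\Pi}\mathit{omit}(r,A)$. An answer set $\hat I$ of $\mathit{omit}(\Pi,A)$ is spurious if there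 is no $I\in AS(\Pi)$ with $I\cap(\mathcal{A}\setminus A)=\hat I$. $\mathit{omit}(\Pi,A)$ is faithful if it has no spurious answer sets, and a faithful $\mathit{omit}(\Pi,A)$ is refinement-safe if for all $A'\subseteq A$, $\mathit{omit}(\Pi,A')$ has no spurious answer sets. -}

module Defs where

open import Data.Nat using (ℕ)
open import Data.Fin using (Fin)
open import Data.Bool using (Bool; true; false; not; _∧_; _∨_)
open import Data.List using (List; []; _∷_; map; filter; _++_)
open import Data.Bool.ListAction using (any)
open import Data.List.Relation.Unary.All using (All)
open import Data.List.Membership.Propositional using (_∈_)
open import Data.Maybe using (Maybe; just; nothing)
open import Data.Sum using (_⊎_; inj₁; inj₂)
open import Data.Product using (Σ; ∃; _×_)
open import Data.Empty using (⊥)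
open import Relation.Binary.PropositionalEquality using (_≡_)
open import Relation.Nullary using (¬_)
open import Relation.Nullary.Decidable using (does)

Interp : Set → Set
Interp X = X → Bool

_⊆_ : {X : Set} → Interp X → Interp X → Set
J ⊆ I = ∀ x → J x ≡ true → I x ≡ true

-- Normal (choice-free) rules over atom type X; head nothing = ⊥.

record NRule (X : Set) : Set where
  constructor nrule
  field
    nhead : Maybe X
    npos  : List X
    nneg  : List X
open NRule public

NProgram : Set → Set
NProgram X = List (NRule X)

BodyTrue : {X : Set} → Interp X → NRule X → Set
BodyTrue I r = All (λ a → I a ≡ true) (npos r) × All (λ a → I a ≡ false) (nneg r)

HeadTrue : {X : Set} → Interp X → Maybe X → Set
HeadTrue I (just a) = I a ≡ true
HeadTrue I nothing  = ⊥

SatN : {X : Set} → Interp X → NRule X → Set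
SatN J r = BodyTrue J r → HeadTrue J (nhead r)

ModelOfReduct : {X : Set} → NProgram X → Interp X → Interp X → Set
ModelOfReduct P I J = ∀ r → r ∈ P → BodyTrue I r → SatN J r

IsAnswerSetN : {X : Set} → NProgram X → Interp X → Set
IsAnswerSetN P I =
  ModelOfReduct P I I × (∀ J → J ⊆ I → ModelOfReduct P I J → I ⊆ J)

data Head (X : Set) : Set where
  atom   : X → Head X
  bot    : Head X
  choice : X → Head X

record Rule (X : Set) : Set where
  constructor rule
  field
    head : Head X
    pos  : List X
    neg  : List X
open Rule public

Program : ℕ → Set
Program n = List (Rule (Fin n))

-- Expansion of choice rules using a fresh atom ᾱ = inj₂ α for each α.
expandRule : {n : ℕ} → Rule (Fin n) → NProgram (Fin n ⊎ Fin n)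
expandRule (rule (atom h) p m) = nrule (just (inj₁ h)) (map inj₁ p) (map inj₁ m) ∷ []
expandRule (rule bot p m) = nrule nothing (map inj₁ p) (map inj₁ m) ∷ []
expandRule (rule (choice h) p m) =
  nrule (just (inj₁ h)) (map inj₁ p) (inj₂ h ∷ map inj₁ m) ∷
  nrule (just (inj₂ h)) (map inj₁ p) (inj₁ h ∷ map inj₁ m) ∷ []

expand : {n : ℕ} → Program n → NProgram (Fin n ⊎ Fin n)
expand [] = []
expand (r ∷ rs) = expandRule r ++ expand rs

-- I ∈ AS(Π): projection onto 𝒜 of an answer set of the expansion.
IsAnswerSet : {n : ℕ} → Program n → Interp (Fin n) → Set
IsAnswerSet Π I =
  Σ (Interp (Fin _ ⊎ Fin _)) λ J →
    IsAnswerSetN (expand Π) J × (∀ i → J (inj₁ i) ≡ I i)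

Unsatisfiable : {n : ℕ} → Program n → Set
Unsatisfiable Π = ¬ (Σ (Interp (Fin _)) λ I → IsAnswerSet Π I)

-- omit(r, A), A ⊆ 𝒜 given as characteristic function.

removeA : {n : ℕ} → Interp (Fin n) → List (Fin n) → List (Fin n)
removeA A = filter (λ a → not (A a) Data.Bool.≟ true)

overlaps : {n : ℕ} → Interp (Fin n) → Rule (Fin n) → Bool
overlaps A r = any A (pos r ++ neg r)

omitAux : {n : ℕ} → Interp (Fin n) → Rule (Fin n) → Bool → List (Rule (Fin n))
omitAux A (rule (atom h) p m) false with A h
... | false = rule (atom h) p m ∷ []
... | true  = []
omitAux A (rule (choice h) p m) false with A h
... | false = rule (choice h) p m ∷ []
... | true  = []
omitAux A (rule bot p m) false = rule bot p m ∷ []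
omitAux A (rule (atom h) p m) true with A h
... | false = rule (choice h) (removeA A p) (removeA A m) ∷ []
... | true  = []
omitAux A (rule (choice h) p m) true with A h
... | false = rule (choice h) (removeA A p) (removeA A m) ∷ []
... | true  = []
omitAux A (rule bot p m) true = []

omitRule : {n : ℕ} → Interp (Fin n) → Rule (Fin n) → List (Rule (Fin n))
omitRule A r = omitAux A r (overlaps A r)

omit : {n : ℕ} → Program n → Interp (Fin n) → Program n
omit [] A = []
omit (r ∷ rs) A = omitRule A r ++ omit rs A

Spurious : {n : ℕ} → Program n → Interp (Fin n) → Interp (Fin n) → Set
Spurious Π A Î =
  IsAnswerSet (omit Π A) Î ×
  ¬ (Σ (Interp (Fin _)) λ I → IsAnswerSet Π I × (∀ i → (I i ∧ not (A i)) ≡ Î i))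

NoSpurious : {n : ℕ} → Program n → Interp (Fin n) → Set
NoSpurious Π A = ∀ Î → ¬ Spurious Π A Î

Faithful : {n : ℕ} → Program n → Interp (Fin n) → Set
Faithful = NoSpurious

RefinementSafe : {n : ℕ} → Program n → Interp (Fin n) → Set
RefinementSafe Π A =
  Faithful Π A × (∀ A' → A' ⊆ A → NoSpurious Π A')

module Submission where

-- Both properties say that omit(Π,A') has no spurious answer set for every
-- A' ⊆ A.  Since a spurious answer set is in particular an answer set, it
-- suffices to show that omit(Π,A') is unsatisfiable whenever A' ⊆ A.  This
-- follows from the over-approximation property of omission: if I is an
-- answer set of omit(Π,A') then I ∖ A is an answer set of omit(Π,A).

open import Defs
open import Data.Nat using (ℕ)
open import Data.Fin using (Fin; _≟_)
open import Data.Bool using (Bool; true; false; not; _∧_; if_then_else_)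
import Data.Bool as Bool
open import Data.Bool.ListAction using (any)
open import Data.List using (List; []; _∷_; map; _++_)
open import Data.List.Relation.Unary.All as All using (All; []; _∷_)
import Data.List.Relation.Unary.All.Properties as AllP
open import Data.List.Relation.Unary.Any as Any using (Any; here; there)
open import Data.List.Membership.Propositional using (_∈_; find; lose)
open import Data.List.Membership.Propositional.Properties
  using (∈-++⁺ˡ; ∈-++⁺ʳ; ∈-++⁻; ∈-filter⁺; ∈-filter⁻)
open import Data.Maybe using (just; nothing)
open import Data.Sum using (_⊎_; inj₁; inj₂)
open import Data.Product using (∃; _×_; _,_; proj₁; proj₂)
open import Relation.Binary.PropositionalEquality using (_≡_; refl; sym; trans; cong)
open import Relation.Nullary using (Dec; yes; no; does; _×-dec_)
open import Relation.Nullary.Decidable using (dec-true)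

true≢false : true ≡ false → {A : Set} → A
true≢false ()

∧-not-true : ∀ {x y : Bool} → x ∧ not y ≡ true → x ≡ true × y ≡ false
∧-not-true {true} {false} _ = refl , refl

∧-not-intro : ∀ {x y : Bool} → x ≡ true → y ≡ false → x ∧ not y ≡ true
∧-not-intro refl refl = refl

∧-false : ∀ {x y : Bool} → x ≡ false → x ∧ y ≡ false
∧-false refl = refl

∧-not-false : ∀ {x y : Bool} → x ∧ not y ≡ false → y ≡ false → x ≡ false
∧-not-false {false} _ _ = refl
∧-not-false {true} e refl = e

not-∧-true : ∀ {x y : Bool} → not x ∧ y ≡ true → x ≡ false × y ≡ true
not-∧-true {false} e = refl , e

not-∧-intro : ∀ {x y : Bool} → x ≡ false → y ≡ true → not x ∧ y ≡ true
not-∧-intro refl refl = refl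

not-∧-of-true : ∀ {x y : Bool} → x ≡ true → not x ∧ y ≡ false
not-∧-of-true refl = refl

not-true : ∀ {x : Bool} → not x ≡ true → x ≡ false
not-true {false} _ = refl

not-false : ∀ {x : Bool} → x ≡ false → not x ≡ true
not-false refl = refl

⊆-false : ∀ {X : Set} {J I : Interp X} → J ⊆ I → ∀ {x} → I x ≡ false → J x ≡ false
⊆-false {J = J} J⊆I {x} Ix with J x in Jx
... | false = refl
... | true = true≢false (trans (sym (J⊆I x Jx)) Ix)

module _ {X : Set} where

  Holds Fails : Interp X → List X → Set
  Holds I = All (λ a → I a ≡ true)
  Fails I = All (λ a → I a ≡ false)

  _⊆_∖_ : List X → List X → Interp X → Set
  ys ⊆ xs ∖ B = ∀ {x} → x ∈ ys → x ∈ xs × B x ≡ false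

  all-on-sub : ∀ {P Q : X → Set} {xs ys B} → ys ⊆ xs ∖ B →
               (∀ {x} → P x → B x ≡ false → Q x) → All P xs → All Q ys
  all-on-sub sub f ps =
    All.tabulate λ y∈ → f (All.lookup ps (proj₁ (sub y∈))) (proj₂ (sub y∈))

  self-⊆∖ : ∀ {B xs} → Fails B xs → xs ⊆ xs ∖ B
  self-⊆∖ avoid x∈ = x∈ , All.lookup avoid x∈

  any-false⇒Fails : ∀ {A : Interp X} xs → any A xs ≡ false → Fails A xs
  any-false⇒Fails [] _ = []
  any-false⇒Fails {A} (x ∷ xs) e with A x in Ax
  ... | false = Ax ∷ any-false⇒Fails xs e

  Fails⇒any-false : ∀ {A : Interp X} {xs} → Fails A xs → any A xs ≡ false
  Fails⇒any-false [] = refl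
  Fails⇒any-false {A} {x ∷ _} (Ax ∷ fs) rewrite Ax = Fails⇒any-false fs

module _ {n : ℕ} where

  base : Interp (Fin n ⊎ Fin n) → Interp (Fin n)
  base J a = J (inj₁ a)

  data Defines (h : Fin n) : Head (Fin n) → Set where
    defines-atom   : Defines h (atom h)
    defines-choice : Defines h (choice h)

  HeadOutside : Interp (Fin n) → Head (Fin n) → Set
  HeadOutside A hd = ∀ {h} → Defines h hd → A h ≡ false

  outside : ∀ {A h hd} → Defines h hd → A h ≡ false → HeadOutside A hd
  outside defines-atom Ah defines-atom = Ah
  outside defines-choice Ah defines-choice = Ah

  data Expansion : Rule (Fin n) → NRule (Fin n ⊎ Fin n) → Set where
    normal     : ∀ {h p m} → Expansion (rule (atom h) p m)
                   (nrule (just (inj₁ h)) (map inj₁ p) (map inj₁ m))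
    constraint : ∀ {p m} → Expansion (rule bot p m)
                   (nrule nothing (map inj₁ p) (map inj₁ m))
    choose-in  : ∀ {h p m} → Expansion (rule (choice h) p m)
                   (nrule (just (inj₁ h)) (map inj₁ p) (inj₂ h ∷ map inj₁ m))
    choose-out : ∀ {h p m} → Expansion (rule (choice h) p m)
                   (nrule (just (inj₂ h)) (map inj₁ p) (inj₁ h ∷ map inj₁ m))

  expansion-view : ∀ {r r'} → r' ∈ expandRule r → Expansion r r'
  expansion-view {rule (atom h) p m} (here refl) = normal
  expansion-view {rule bot p m} (here refl) = constraint
  expansion-view {rule (choice h) p m} (here refl) = choose-in
  expansion-view {rule (choice h) p m} (there (here refl)) = choose-out

  expansion-∈ : ∀ {r r'} → Expansion r r' → r' ∈ expandRule r
  expansion-∈ normal = here refl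
  expansion-∈ constraint = here refl
  expansion-∈ choose-in = here refl
  expansion-∈ choose-out = there (here refl)

  expand-∈⁻ : ∀ (P : Program n) {r'} → r' ∈ expand P → ∃ λ r → r ∈ P × Expansion r r'
  expand-∈⁻ (r ∷ P) r'∈ with ∈-++⁻ (expandRule r) r'∈
  ... | inj₁ r'∈r = r , here refl , expansion-view r'∈r
  ... | inj₂ r'∈P with expand-∈⁻ P r'∈P
  ...   | r₀ , r₀∈ , e = r₀ , there r₀∈ , e

  expand-∈⁺ : ∀ {P : Program n} {r r'} → r ∈ P → Expansion r r' → r' ∈ expand P
  expand-∈⁺ {r ∷ P} (here refl) e = ∈-++⁺ˡ (expansion-∈ e)
  expand-∈⁺ {r ∷ P} (there r∈) e = ∈-++⁺ʳ (expandRule r) (expand-∈⁺ r∈ e)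

  -- A model L of the reduct of expand Q w.r.t. I derives h from any rule of
  -- Q defining h whose body holds in I and in L (with ᾱ false in both, which
  -- matters only for choice rules).
  derive : ∀ {Q : Program n} {I L hd h p m} → ModelOfReduct (expand Q) I L →
           rule hd p m ∈ Q → Defines h hd →
           Holds (base I) p → Fails (base I) m → I (inj₂ h) ≡ false →
           Holds (base L) p → Fails (base L) m → L (inj₂ h) ≡ false →
           L (inj₁ h) ≡ true
  derive L-model q∈ defines-atom hI fI _ hL fL _ =
    L-model _ (expand-∈⁺ q∈ normal) (AllP.map⁺ hI , AllP.map⁺ fI) (AllP.map⁺ hL , AllP.map⁺ fL)
  derive L-model q∈ defines-choice hI fI h̄I hL fL h̄L =
    L-model _ (expand-∈⁺ q∈ choose-in)
      (AllP.map⁺ hI , h̄I ∷ AllP.map⁺ fI) (AllP.map⁺ hL , h̄L ∷ AllP.map⁺ fL)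

  -- Firing choice rules, decidably; needed to define the fresh atoms of the
  -- restricted answer set as a Boolean function.
  choice? : (h : Fin n) (hd : Head (Fin n)) → Dec (hd ≡ choice h)
  choice? h (choice h') with h' ≟ h
  ... | yes refl = yes refl
  ... | no h'≢h = no λ { refl → h'≢h refl }
  choice? h (atom _) = no λ ()
  choice? h bot = no λ ()

  Fires : Interp (Fin n) → Rule (Fin n) → Set
  Fires I r = Holds I (pos r) × Fails I (neg r)

  fires? : (I : Interp (Fin n)) (r : Rule (Fin n)) → Dec (Fires I r)
  fires? I r = All.all? (λ a → I a Bool.≟ true) (pos r)
         ×-dec All.all? (λ a → I a Bool.≟ false) (neg r)

  Supported : Interp (Fin n) → Program n → Fin n → Set
  Supported I Q h = Any (λ r → head r ≡ choice h × Fires I r) Q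

  supported? : (I : Interp (Fin n)) (Q : Program n) (h : Fin n) → Dec (Supported I Q h)
  supported? I Q h = Any.any? (λ r → choice? h (head r) ×-dec fires? I r) Q

  supported-intro : ∀ {I Q h p m} → rule (choice h) p m ∈ Q → Holds I p → Fails I m →
                    does (supported? I Q h) ≡ true
  supported-intro q∈ hp fm = dec-true (supported? _ _ _) (lose q∈ (refl , hp , fm))

  supported-elim : ∀ {I Q h} → does (supported? I Q h) ≡ true →
                   ∃ λ p → ∃ λ m → rule (choice h) p m ∈ Q × Holds I p × Fails I m
  supported-elim {I} {Q} {h} e with supported? I Q h | e
  ... | yes s | _ with find s
  ...   | rule _ p m , q∈ , refl , hp , fm = p , m , q∈ , hp , fm

  record Covering (B : Interp (Fin n)) (Q : Program n) (r : Rule (Fin n)) (h : Fin n) : Set where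
    constructor covering
    field
      {chead}   : Head (Fin n)
      {cpos}    : List (Fin n)
      {cneg}    : List (Fin n)
      member    : rule chead cpos cneg ∈ Q
      defines   : Defines h chead
      pos-sub   : cpos ⊆ pos r ∖ B
      neg-sub   : cneg ⊆ neg r ∖ B

  record Abstracts (B : Interp (Fin n)) (P Q : Program n) : Set where
    field
      normal-sound     : ∀ {h p m} → rule (atom h) p m ∈ Q →
                         rule (atom h) p m ∈ P × B h ≡ false × Fails B m
      constraint-sound : ∀ {p m} → rule bot p m ∈ Q → rule bot p m ∈ P × Fails B m
      covered          : ∀ {r h} → r ∈ P → Defines h (head r) → B h ≡ false → Covering B Q r h

  module Restriction {B : Interp (Fin n)} {P Q : Program n} (abs : Abstracts B P Q)
                     (J : Interp (Fin n ⊎ Fin n)) (J-answer : IsAnswerSetN (expand P) J) where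
    open Abstracts abs

    J-model : ModelOfReduct (expand P) J J
    J-model = proj₁ J-answer

    K₁ : Interp (Fin n)
    K₁ a = J (inj₁ a) ∧ not (B a)

    K : Interp (Fin n ⊎ Fin n)
    K (inj₁ a) = K₁ a
    K (inj₂ h) = not (K₁ h) ∧ does (supported? K₁ Q h)

    K-body⇒J : ∀ {p m} → Holds K₁ p → Fails K₁ m → Fails B m →
               Holds J (map inj₁ p) × Fails J (map inj₁ m)
    K-body⇒J hK fK avoid =
      AllP.map⁺ (All.map (λ e → proj₁ (∧-not-true e)) hK) ,
      AllP.map⁺ (All.zipWith (λ (e , Ba) → ∧-not-false e Ba) (fK , avoid))

    K-model : ModelOfReduct (expand Q) K K
    K-model _ r'∈ (hK , fK) _ with expand-∈⁻ Q r'∈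
    ... | _ , r∈ , normal with normal-sound r∈
    ...   | r∈P , Bh , avoid =
            ∧-not-intro (J-model _ (expand-∈⁺ r∈P normal) bodyJ bodyJ) Bh
      where bodyJ = K-body⇒J (AllP.map⁻ hK) (AllP.map⁻ fK) avoid
    K-model _ r'∈ (hK , fK) _ | _ , r∈ , constraint with constraint-sound r∈
    ...   | r∈P , avoid = J-model _ (expand-∈⁺ r∈P constraint) bodyJ bodyJ
      where bodyJ = K-body⇒J (AllP.map⁻ hK) (AllP.map⁻ fK) avoid
    K-model _ r'∈ (hK , h̄K ∷ fK) _ | rule (choice h) _ _ , r∈ , choose-in with K₁ h in Kh
    ... | true = refl
    ... | false =
      true≢false (trans (sym (supported-intro r∈ (AllP.map⁻ hK) (AllP.map⁻ fK))) h̄K)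
    K-model _ r'∈ (hK , hK-false ∷ fK) _ | _ , r∈ , choose-out =
      not-∧-intro hK-false (supported-intro r∈ (AllP.map⁻ hK) (AllP.map⁻ fK))

    -- J' agrees with J on
    -- B and on fresh atoms and with L elsewhere; it is a model of the reduct
    -- of expand P below J, hence equal to J, which forces K ⊆ L.
    module Minimal (L : Interp (Fin n ⊎ Fin n)) (L⊆K : L ⊆ K)
                   (L-model : ModelOfReduct (expand Q) K L) where

      J' : Interp (Fin n ⊎ Fin n)
      J' (inj₁ a) = if B a then J (inj₁ a) else L (inj₁ a)
      J' (inj₂ a) = J (inj₂ a)

      J'-outside : ∀ {a} → B a ≡ false → J' (inj₁ a) ≡ L (inj₁ a)
      J'-outside Ba rewrite Ba = refl

      J'⊆J : J' ⊆ J
      J'⊆J (inj₁ a) e with B a in Ba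
      ... | true = e
      ... | false = proj₁ (∧-not-true (L⊆K (inj₁ a) e))
      J'⊆J (inj₂ a) e = e

      -- An atom outside B derived by a rule of P is derived in J' through
      -- its covering rule in Q.
      J'-derives : ∀ {r h} → r ∈ P → Defines h (head r) →
                   Holds (base J) (pos r) → Fails (base J) (neg r) →
                   Holds (base J') (pos r) → Fails (base J') (neg r) →
                   J (inj₁ h) ≡ true → J' (inj₁ h) ≡ true
      J'-derives {h = h} r∈ d hJ fJ hJ' fJ' Jh with B h in Bh
      ... | true = Jh
      ... | false =
        derive L-model member defines
          (all-on-sub pos-sub ∧-not-intro hJ)
          (all-on-sub neg-sub (λ Ja _ → ∧-false Ja) fJ)
          h̄K
          (all-on-sub pos-sub (λ e Ba → trans (sym (J'-outside Ba)) e) hJ')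
          (all-on-sub neg-sub (λ e Ba → trans (sym (J'-outside Ba)) e) fJ')
          (⊆-false L⊆K h̄K)
        where
          open Covering (covered r∈ d Bh)
          h̄K : K (inj₂ h) ≡ false
          h̄K = not-∧-of-true (∧-not-intro Jh Bh)

      J'-model : ModelOfReduct (expand P) J J'
      J'-model r' r'∈ bJ bJ' with expand-∈⁻ P r'∈
      ... | _ , r∈ , normal =
            J'-derives r∈ defines-atom (AllP.map⁻ (proj₁ bJ)) (AllP.map⁻ (proj₂ bJ))
              (AllP.map⁻ (proj₁ bJ')) (AllP.map⁻ (proj₂ bJ')) (J-model r' r'∈ bJ bJ)
      ... | _ , r∈ , constraint = J-model r' r'∈ bJ bJ
      ... | _ , r∈ , choose-out = J-model r' r'∈ bJ bJ
      J'-model r' r'∈ bJ@(hJ , _ ∷ fJ) (hJ' , _ ∷ fJ') | _ , r∈ , choose-in =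
        J'-derives r∈ defines-choice (AllP.map⁻ hJ) (AllP.map⁻ fJ)
          (AllP.map⁻ hJ') (AllP.map⁻ fJ') (J-model r' r'∈ bJ bJ)

      J⊆J' : J ⊆ J'
      J⊆J' = proj₂ J-answer J' J'⊆J J'-model

      K₁⊆L : ∀ a → K₁ a ≡ true → L (inj₁ a) ≡ true
      K₁⊆L a e with ∧-not-true e
      ... | Ja , Ba = trans (sym (J'-outside Ba)) (J⊆J' (inj₁ a) Ja)

      K⊆L : K ⊆ L
      K⊆L (inj₁ a) e = K₁⊆L a e
      K⊆L (inj₂ h) e with not-∧-true e
      ... | Kh , s with supported-elim {K₁} {Q} {h} s
      ...   | p , m , q∈ , hp , fm =
              L-model _ (expand-∈⁺ q∈ choose-out)
                (AllP.map⁺ hp , Kh ∷ AllP.map⁺ fm)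
                (AllP.map⁺ (All.map (K₁⊆L _) hp) ,
                 ⊆-false L⊆K Kh ∷ AllP.map⁺ (All.map (⊆-false L⊆K) fm))

    K-answer : IsAnswerSetN (expand Q) K
    K-answer = K-model , λ L L⊆K L-model → Minimal.K⊆L L L⊆K L-model

  restrict-answer-set : ∀ {B P Q I} → Abstracts B P Q →
                        IsAnswerSet P I → IsAnswerSet Q (λ a → I a ∧ not (B a))
  restrict-answer-set {B} abs (J , J-answer , J≡I) =
    K , K-answer , λ a → cong (_∧ not (B a)) (J≡I a)
    where open Restriction abs J J-answer

  weaken : Interp (Fin n) → Fin n → Rule (Fin n) → Rule (Fin n)
  weaken A h r = rule (choice h) (removeA A (pos r)) (removeA A (neg r))

  data Omitted (A : Interp (Fin n)) (r : Rule (Fin n)) : Rule (Fin n) → Set where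
    kept     : overlaps A r ≡ false → HeadOutside A (head r) → Omitted A r r
    weakened : ∀ {h} → overlaps A r ≡ true → Defines h (head r) → A h ≡ false →
               Omitted A r (weaken A h r)

  omitted-view : ∀ A r {q} → q ∈ omitRule A r → Omitted A r q
  omitted-view A (rule hd p m) q∈ with overlaps A (rule hd p m) in ov
  omitted-view A (rule (atom h) p m) q∈ | false with A h in Ah
  omitted-view A (rule (atom h) p m) (here refl) | false | false = kept ov (outside defines-atom Ah)
  omitted-view A (rule (choice h) p m) q∈ | false with A h in Ah
  omitted-view A (rule (choice h) p m) (here refl) | false | false = kept ov (outside defines-choice Ah)
  omitted-view A (rule bot p m) (here refl) | false = kept ov λ ()
  omitted-view A (rule (atom h) p m) q∈ | true with A h in Ah
  omitted-view A (rule (atom h) p m) (here refl) | true | false = weakened ov defines-atom Ah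
  omitted-view A (rule (choice h) p m) q∈ | true with A h in Ah
  omitted-view A (rule (choice h) p m) (here refl) | true | false = weakened ov defines-choice Ah

  kept-∈ : ∀ A r → overlaps A r ≡ false → HeadOutside A (head r) → r ∈ omitRule A r
  kept-∈ A (rule hd p m) ov out with overlaps A (rule hd p m) | ov
  kept-∈ A (rule (atom h) p m) ov out | false | _ with A h | out defines-atom
  ... | false | _ = here refl
  kept-∈ A (rule (choice h) p m) ov out | false | _ with A h | out defines-choice
  ... | false | _ = here refl
  kept-∈ A (rule bot p m) ov out | false | _ = here refl

  weakened-∈ : ∀ A r {h} → overlaps A r ≡ true → Defines h (head r) → A h ≡ false →
               weaken A h r ∈ omitRule A r
  weakened-∈ A (rule hd p m) ov d Ah with overlaps A (rule hd p m) | ov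
  weakened-∈ A (rule (atom h) p m) ov defines-atom Ah | true | _ with A h | Ah
  ... | false | _ = here refl
  weakened-∈ A (rule (choice h) p m) ov defines-choice Ah | true | _ with A h | Ah
  ... | false | _ = here refl

  omit-∈⁻ : ∀ (Π : Program n) A {q} → q ∈ omit Π A → ∃ λ r → r ∈ Π × q ∈ omitRule A r
  omit-∈⁻ (r ∷ Π) A q∈ with ∈-++⁻ (omitRule A r) q∈
  ... | inj₁ q∈r = r , here refl , q∈r
  ... | inj₂ q∈Π with omit-∈⁻ Π A q∈Π
  ...   | r₀ , r₀∈ , q∈r₀ = r₀ , there r₀∈ , q∈r₀

  omit-∈⁺ : ∀ {Π : Program n} {A r q} → r ∈ Π → q ∈ omitRule A r → q ∈ omit Π A
  omit-∈⁺ {r ∷ Π} (here refl) q∈ = ∈-++⁺ˡ q∈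
  omit-∈⁺ {r ∷ Π} {A} (there r∈) q∈ = ∈-++⁺ʳ (omitRule A r) (omit-∈⁺ r∈ q∈)

  removeA-⊆∖ : ∀ {A : Interp (Fin n)} {xs ys} → (∀ {x} → x ∈ xs → A x ≡ false → x ∈ ys) →
               removeA A xs ⊆ ys ∖ A
  removeA-⊆∖ {A} {xs} retains x∈ with ∈-filter⁻ (λ a → not (A a) Bool.≟ true) {xs = xs} x∈
  ... | x∈xs , nAx = retains x∈xs (not-true nAx) , not-true nAx

  removeA-retains : ∀ {A' A : Interp (Fin n)} {xs} → A' ⊆ A →
                    ∀ {x} → x ∈ xs → A x ≡ false → x ∈ removeA A' xs
  removeA-retains {A'} A'⊆A x∈ Ax =
    ∈-filter⁺ (λ a → not (A' a) Bool.≟ true) x∈ (not-false (⊆-false A'⊆A Ax))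

  overlaps-false : ∀ {A : Interp (Fin n)} r → overlaps A r ≡ false →
                   Fails A (pos r) × Fails A (neg r)
  overlaps-false r e = AllP.++⁻ (pos r) (any-false⇒Fails (pos r ++ neg r) e)

  overlaps-anti : ∀ {A' A : Interp (Fin n)} → A' ⊆ A →
                  ∀ r → overlaps A r ≡ false → overlaps A' r ≡ false
  overlaps-anti A'⊆A r e =
    Fails⇒any-false (All.map (⊆-false A'⊆A) (any-false⇒Fails (pos r ++ neg r) e))

  overlaps-mono : ∀ {A' A : Interp (Fin n)} → A' ⊆ A →
                  ∀ r → overlaps A' r ≡ true → overlaps A r ≡ true
  overlaps-mono {A = A} A'⊆A r e with overlaps A r in ov
  ... | true = refl
  ... | false = true≢false (trans (sym e) (overlaps-anti A'⊆A r ov))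

  module _ (Π : Program n) {A : Interp (Fin n)} where

    weakening-covers : ∀ {r h r'} → r ∈ Π → overlaps A r ≡ true →
                       Defines h (head r) → A h ≡ false →
                       (∀ {x} → x ∈ pos r → A x ≡ false → x ∈ pos r') →
                       (∀ {x} → x ∈ neg r → A x ≡ false → x ∈ neg r') →
                       Covering A (omit Π A) r' h
    weakening-covers {r} r∈ ov d Ah pos-retained neg-retained =
      covering (omit-∈⁺ r∈ (weakened-∈ A r ov d Ah)) defines-choice
        (removeA-⊆∖ pos-retained) (removeA-⊆∖ neg-retained)

    kept-covers : ∀ {r h} → r ∈ Π → overlaps A r ≡ false →
                  Defines h (head r) → A h ≡ false →
                  Covering A (omit Π A) r h
    kept-covers {r} r∈ ov d Ah =
      covering (omit-∈⁺ r∈ (kept-∈ A r ov (outside d Ah))) d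
        (self-⊆∖ (proj₁ (overlaps-false r ov))) (self-⊆∖ (proj₂ (overlaps-false r ov)))

  module _ (Π : Program n) {A' A : Interp (Fin n)} (A'⊆A : A' ⊆ A) where

    omitted-normal-sound : ∀ {h p m} → rule (atom h) p m ∈ omit Π A →
                           rule (atom h) p m ∈ omit Π A' × A h ≡ false × Fails A m
    omitted-normal-sound q∈ with omit-∈⁻ Π A q∈
    ... | r , r∈ , q∈r with omitted-view A r q∈r
    ...   | kept ov out =
            omit-∈⁺ r∈ (kept-∈ A' r (overlaps-anti A'⊆A r ov) (λ d → ⊆-false A'⊆A (out d))) ,
            out defines-atom , proj₂ (overlaps-false r ov)

    omitted-constraint-sound : ∀ {p m} → rule bot p m ∈ omit Π A →
                               rule bot p m ∈ omit Π A' × Fails A m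
    omitted-constraint-sound q∈ with omit-∈⁻ Π A q∈
    ... | r , r∈ , q∈r with omitted-view A r q∈r
    ...   | kept ov _ =
            omit-∈⁺ r∈ (kept-∈ A' r (overlaps-anti A'⊆A r ov) λ ()) , proj₂ (overlaps-false r ov)

    -- A rule of omit(Π,A') stems from a rule r of Π, which is either kept or
    -- weakened in omit(Π,A) depending on whether it meets A.
    omitted-covered : ∀ {r' h} → r' ∈ omit Π A' → Defines h (head r') → A h ≡ false →
                      Covering A (omit Π A) r' h
    omitted-covered r'∈ d Ah with omit-∈⁻ Π A' r'∈
    ... | r , r∈ , r'∈r with omitted-view A' r r'∈r | d
    ...   | weakened ov' d' _ | defines-choice =
            weakening-covers Π r∈ (overlaps-mono A'⊆A r ov') d' Ah
              (removeA-retains A'⊆A) (removeA-retains A'⊆A)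
    ...   | kept _ _ | _ with overlaps A r in ov
    ...     | true = weakening-covers Π r∈ ov d Ah (λ x∈ _ → x∈) (λ x∈ _ → x∈)
    ...     | false = kept-covers Π r∈ ov d Ah

    omit-abstracts : Abstracts A (omit Π A') (omit Π A)
    omit-abstracts = record
      { normal-sound     = omitted-normal-sound
      ; constraint-sound = omitted-constraint-sound
      ; covered          = omitted-covered
      }

omit-refines : ∀ {n} (Π : Program n) {A' A I} → A' ⊆ A →
               IsAnswerSet (omit Π A') I → IsAnswerSet (omit Π A) (λ a → I a ∧ not (A a))
omit-refines Π A'⊆A = restrict-answer-set (omit-abstracts Π A'⊆A)

proposition9 : (n : ℕ) (Π : Program n) (A : Interp (Fin n)) →
    Unsatisfiable (omit Π A) → RefinementSafe Π A
proposition9 n Π A unsat = no-spurious A (λ _ e → e) , no-spurious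
  where
    -- a spurious answer set of omit(Π,A') would induce one of omit(Π,A)
    no-spurious : ∀ A' → A' ⊆ A → NoSpurious Π A'
    no-spurious A' A'⊆A Î (Î-answer , _) = unsat (_ , omit-refines Π A'⊆A Î-answer)
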